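{- Let $G$ be a connected graph and $n$ a positive integer. If $\Pi$ is a resolving partition for $G\odot K_n$ of cardinality $n+1$, then for every vertex $v$ of $G\odot K_n$ and every $A\in\Pi$, $d(v,A)\le 3$.
   Context: $K_n$ is the complete graph of order $n$; $d$ is shortest-path distance in $G\odot K_n$ and $d(v,A)=\min_{u\in A}d(v,u)$. For a connected graph $F$ and an ordered partition $\Pi=\{P_1,\dots,P_t\}$ of $V(F)$, $r(v|\Pi)=(d(v,P_1),\dots,d(v,P_t))$; $\Pi$ is a resolving partition if $r(u|\Pi)\ne r(v|\Pi)$ for all distinct vertices $u,v$. For graphs $G$ of order $n_1$ (vertices $v_1,\dots,v_{n_1}$) and $H$, the corona product $G\odot H$ is obtained from one copy of $G$ and $n_1$ copies $H_1,\dots,H_{n_1}$ of $H$ by joining $v_i$ to every vertex of $H_i$. -}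

module Defs where

open import Data.Nat using (ℕ; zero; suc; _≤_)
open import Data.Fin using (Fin)
open import Data.Bool using (Bool; true; false; T)
open import Data.Sum using (_⊎_; inj₁; inj₂)
open import Data.Product using (_×_; _,_; ∃; ∃-syntax)
open import Relation.Binary.PropositionalEquality using (_≡_; _≢_)
open import Relation.Nullary using (¬_)

record SimpleGraph (m : ℕ) : Set where
  field
    adj   : Fin m → Fin m → Bool
    sym   : ∀ u v → adj u v ≡ adj v u
    irrefl : ∀ u → adj u u ≡ false
open SimpleGraph public

data Walk {V : Set} (Adj : V → V → Set) : V → V → ℕ → Set where
  here : ∀ {u} → Walk Adj u u zero
  step : ∀ {u w v k} → Adj u w → Walk Adj w v k → Walk Adj u v (suc k)

IsDist : {V : Set} (Adj : V → V → Set) → V → V → ℕ → Set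
IsDist Adj u v k = Walk Adj u v k × (∀ j → Walk Adj u v j → k ≤ j)

IsSetDist : {V : Set} (Adj : V → V → Set) → V → (V → Set) → ℕ → Set
IsSetDist Adj v A k =
  (∃[ u ] (A u × IsDist Adj v u k)) ×
  (∀ u j → A u → IsDist Adj v u j → k ≤ j)

Connected : ∀ {m} → SimpleGraph m → Set
Connected {m} G = ∀ (u v : Fin m) → ∃[ k ] Walk (λ x y → T (adj G x y)) u v k

-- Corona product G ⊙ K_n: vertices of G (inj₁ i) and, for each i,
-- a copy of K_n with vertices inj₂ (i , a).
CoronaV : ℕ → ℕ → Set
CoronaV m n = Fin m ⊎ (Fin m × Fin n)

data CoronaAdj {m n : ℕ} (G : SimpleGraph m) : CoronaV m n → CoronaV m n → Set where
  base   : ∀ {i j} → T (adj G i j) → CoronaAdj G (inj₁ i) (inj₁ j)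
  toCopy : ∀ {i a} → CoronaAdj G (inj₁ i) (inj₂ (i , a))
  fromCopy : ∀ {i a} → CoronaAdj G (inj₂ (i , a)) (inj₁ i)
  inCopy : ∀ {i a b} → a ≢ b → CoronaAdj G (inj₂ (i , a)) (inj₂ (i , b))

record OrderedPartition (V : Set) (t : ℕ) : Set where
  field
    cls      : V → Fin t
    nonempty : ∀ (i : Fin t) → ∃[ v ] (cls v ≡ i)
open OrderedPartition public

Class : ∀ {V t} → OrderedPartition V t → Fin t → V → Set
Class Π i v = cls Π v ≡ i

Resolving : ∀ {V t} (Adj : V → V → Set) → OrderedPartition V t → Set
Resolving {V} {t} Adj Π =
  ∀ (u v : V) →
  (∀ (i : Fin t) (k k' : ℕ) →
     IsSetDist Adj u (Class Π i) k → IsSetDist Adj v (Class Π i) k' → k ≡ k') →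
  u ≡ v

-- Two vertices u, v of a graph are indistinguishable by a partition Π when,
-- for every class C, each walk from u to C is matched by a walk from v to C
-- that is no longer, and vice versa; then d(u,C) = d(v,C) for all C, so a
-- resolving partition forces u = v.
module Submission where

open import Defs hiding (sym)
open import Data.Nat using (ℕ; zero; suc; _+_; _≤_; _<_; z≤n; s≤s)
open import Data.Nat.Properties
  using (≮⇒≥; ≤-refl; ≤-trans; <⇒≤; m≤n⇒m≤1+n; n≤1+n; ≤-antisym; 1+n≰n; anyUpTo?)
open import Data.Nat.Induction using (<-rec)
open import Data.Fin using (Fin; _≟_; punchOut)
open import Data.Fin.Properties using (any?; punchOut-injective; injective⇒≤)
open import Data.Product using (_×_; ∃; ∃-syntax; _,_; proj₁; proj₂)
open import Data.Sum using (_⊎_; inj₁; inj₂)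
import Data.Sum.Properties as Sum
import Data.Product.Properties as Product
open import Data.Bool using (T)
open import Data.Empty using (⊥-elim)
open import Function using (_∘_)
open import Function.Definitions using (Injective)
open import Relation.Nullary using (¬_; Dec; yes; no)
open import Relation.Nullary.Decidable using (_×-dec_; _⊎-dec_; map′; T?)
open import Relation.Binary.Definitions using (DecidableEquality)
open import Relation.Binary.PropositionalEquality using (_≡_; _≢_; refl; sym; trans)

LeastWitness : (ℕ → Set) → ℕ → Set
LeastWitness P L = ∃[ k ] (P k × k ≤ L × (∀ j → j < k → ¬ P j))

least : {P : ℕ → Set} → (∀ j → Dec (P j)) → ∀ L → P L → LeastWitness P L
least {P} P? = <-rec (λ L → P L → LeastWitness P L) search
  where
  search : ∀ L → (∀ {L'} → L' < L → P L' → LeastWitness P L') → P L → LeastWitness P L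
  search L smaller PL with anyUpTo? P? L
  ... | yes (L' , L'<L , PL') with smaller L'<L PL'
  ...   | k , Pk , k≤L' , below = k , Pk , ≤-trans k≤L' (<⇒≤ L'<L) , below
  search L smaller PL | no none = L , PL , ≤-refl , λ j j<L Pj → none (j , j<L , Pj)

avoid : ∀ {k m} (f : Fin k → Fin (suc m)) {c : Fin (suc m)} → (∀ a → f a ≢ c) → Fin k → Fin m
avoid f miss a = punchOut (miss a ∘ sym)

avoid-injective : ∀ {k m} {f : Fin k → Fin (suc m)} {c} (miss : ∀ a → f a ≢ c) →
                  Injective _≡_ _≡_ f → Injective _≡_ _≡_ (avoid f miss)
avoid-injective {c = c} miss f-inj eq = f-inj (punchOut-injective {i = c} _ _ eq)

injection-misses-one : ∀ {n} (f : Fin (suc n) → Fin (suc (suc n))) → Injective _≡_ _≡_ f →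
                       ∀ {c} → (∀ a → f a ≢ c) → ∀ c' → c' ≢ c → ∃[ a ] (f a ≡ c')
injection-misses-one f f-inj {c} miss c' c'≢c with any? (λ a → f a ≟ c')
... | yes hit = hit
... | no no-hit = ⊥-elim (1+n≰n (injective⇒≤ (avoid-injective miss' (avoid-injective miss f-inj))))
  where
  miss' : ∀ a → avoid f miss a ≢ punchOut (c'≢c ∘ sym)
  miss' a eq = no-hit (a , punchOut-injective {i = c} _ _ eq)

module Walks {V : Set} (Adj : V → V → Set) where

  Reach : V → (V → Set) → ℕ → Set
  Reach v Q k = ∃[ w ] (Q w × Walk Adj v w k)

  Shortest : V → (V → Set) → ℕ → Set
  Shortest v Q k = Reach v Q k × (∀ j → j < k → ¬ Reach v Q j)

  Dominates : V → V → (V → Set) → Set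
  Dominates u v Q = ∀ k → Reach u Q k → ∃[ j ] (j ≤ k × Reach v Q j)

  step-reach : ∀ {u z Q k} → Adj u z → Reach z Q k → Reach u Q (suc k)
  step-reach e (w , q , walk) = w , q , step e walk

  snoc : ∀ {x y z k} → Walk Adj x y k → Adj y z → Walk Adj x z (suc k)
  snoc here e = step e here
  snoc (step e' walk) e = step e' (snoc walk e)

  shortest⇒setDist : ∀ {v Q k} → Shortest v Q k → IsSetDist Adj v Q k
  shortest⇒setDist ((u , Qu , walk) , below) =
    (u , Qu , walk , λ j walk' → ≮⇒≥ (λ j<k → below j j<k (u , Qu , walk'))) ,
    λ u' j Qu' dist → ≮⇒≥ (λ j<k → below j j<k (u' , Qu' , proj₁ dist))

  shortest⇒dist : ∀ {v w k} → Shortest v (_≡ w) k → IsDist Adj v w k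
  shortest⇒dist ((_ , refl , walk) , below) =
    walk , λ j walk' → ≮⇒≥ (λ j<k → below j j<k (_ , refl , walk'))

  -- If every neighbour of u other than v is a neighbour of v (and v ∈ Q
  -- whenever u ∈ Q), then v dominates u: reroute the first step.
  neighbourhood-dominates : ∀ {u v Q} → (Q u → Q v) → (∀ {z} → Adj u z → z ≡ v ⊎ Adj v z) →
                            Dominates u v Q
  neighbourhood-dominates Qu⇒Qv shared zero (w , Qw , here) = zero , z≤n , (_ , Qu⇒Qv Qw , here)
  neighbourhood-dominates Qu⇒Qv shared (suc k) (w , Qw , step e rest) with shared e
  ... | inj₁ refl = k , n≤1+n k , (w , Qw , rest)
  ... | inj₂ e' = suc k , ≤-refl , (w , Qw , step e' rest)

  near-dominates : ∀ {u v Q} → (Q u → Q v) → ∃[ j ] (j ≤ 1 × Reach v Q j) → Dominates u v Q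
  near-dominates Qu⇒Qv near zero (w , Qw , here) = zero , z≤n , (_ , Qu⇒Qv Qw , here)
  near-dominates Qu⇒Qv (j , j≤1 , r) (suc k) _ = j , ≤-trans j≤1 (s≤s z≤n) , r

  shortest-dominates : ∀ {u v Q D} → Reach v Q D → (∀ j → j < D → ¬ Reach u Q j) → Dominates u v Q
  shortest-dominates r below k ru = _ , ≮⇒≥ (λ k<D → below k k<D ru) , r

module Distances {V : Set} (Adj : V → V → Set)
                 (_≟V_ : DecidableEquality V)
                 (adj? : ∀ x y → Dec (Adj x y))
                 (search : ∀ {P : V → Set} → (∀ v → Dec (P v)) → Dec (∃ P)) where

  open Walks Adj

  reach? : ∀ {Q} → (∀ w → Dec (Q w)) → ∀ v k → Dec (Reach v Q k)
  reach? Q? v zero = map′ (λ q → v , q , here) (λ { (_ , q , here) → q }) (Q? v)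
  reach? Q? v (suc k) =
    map′ (λ { (z , e , r) → step-reach e r }) (λ { (w , q , step e walk) → _ , e , (w , q , walk) })
         (search (λ z → adj? v z ×-dec reach? Q? z k))

  shortest-within : ∀ {v Q L} → (∀ w → Dec (Q w)) → Reach v Q L → ∃[ k ] (Shortest v Q k × k ≤ L)
  shortest-within {v} {L = L} Q? r with least (reach? Q? v) L r
  ... | k , rk , k≤L , below = k , (rk , below) , k≤L

  setDist-within : ∀ {v Q L} → (∀ w → Dec (Q w)) → Reach v Q L → ∃[ k ] (IsSetDist Adj v Q k × k ≤ L)
  setDist-within Q? r with shortest-within Q? r
  ... | k , sh , k≤L = k , shortest⇒setDist sh , k≤L

  -- The set distance is at most the length of any walk into the set; this
  -- goes through the exact distance to the endpoint of that walk.
  setDist-minimal : ∀ {v Q k j} → IsSetDist Adj v Q k → Reach v Q j → k ≤ j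
  setDist-minimal dist (w , Qw , walk) with shortest-within (_≟V w) (w , refl , walk)
  ... | k' , sh , k'≤j = ≤-trans (proj₂ dist w k' Qw (shortest⇒dist sh)) k'≤j

  mutual-dominance⇒same-setDist : ∀ {u v Q k k'} → Dominates u v Q → Dominates v u Q →
                                  IsSetDist Adj u Q k → IsSetDist Adj v Q k' → k ≡ k'
  mutual-dominance⇒same-setDist u≼v v≼u du@((_ , Qu , walk-u , _) , _) dv@((_ , Qv , walk-v , _) , _)
    with u≼v _ (_ , Qu , walk-u) | v≼u _ (_ , Qv , walk-v)
  ... | j , j≤k , rv | j' , j'≤k' , ru =
    ≤-antisym (≤-trans (setDist-minimal du ru) j'≤k') (≤-trans (setDist-minimal dv rv) j≤k)

  Unresolved : ∀ {t} → OrderedPartition V t → V → V → Set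
  Unresolved Π u v = ∀ C → Dominates u v (Class Π C) × Dominates v u (Class Π C)

  unresolved⇒equal : ∀ {t} {Π : OrderedPartition V t} → Resolving Adj Π →
                     ∀ {u v} → Unresolved Π u v → u ≡ v
  unresolved⇒equal res {u} {v} unres =
    res u v λ C k k' du dv → mutual-dominance⇒same-setDist (proj₁ (unres C)) (proj₂ (unres C)) du dv

module Corona {m n : ℕ} (G : SimpleGraph m) where

  Vertex : Set
  Vertex = CoronaV m n

  Edge : Vertex → Vertex → Set
  Edge = CoronaAdj G

  _≟V_ : DecidableEquality Vertex
  _≟V_ = Sum.≡-dec _≟_ (Product.≡-dec _≟_ _≟_)

  edge? : ∀ x y → Dec (Edge x y)
  edge? (inj₁ i) (inj₁ j) = map′ base (λ { (base t) → t }) (T? (adj G i j))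
  edge? (inj₁ i) (inj₂ (j , a)) with i ≟ j
  ... | yes refl = yes toCopy
  ... | no i≢j = no λ { toCopy → i≢j refl }
  edge? (inj₂ (i , a)) (inj₁ j) with i ≟ j
  ... | yes refl = yes fromCopy
  ... | no i≢j = no λ { fromCopy → i≢j refl }
  edge? (inj₂ (i , a)) (inj₂ (j , b)) with i ≟ j | a ≟ b
  ... | no i≢j | _ = no λ { (inCopy _) → i≢j refl }
  ... | yes refl | yes refl = no λ { (inCopy a≢a) → a≢a refl }
  ... | yes refl | no a≢b = yes (inCopy a≢b)

  search : ∀ {P : Vertex → Set} → (∀ v → Dec (P v)) → Dec (∃ P)
  search P? = map′ from to (any? (P? ∘ inj₁) ⊎-dec any? (λ i → any? (λ a → P? (inj₂ (i , a)))))
    where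
    from : _ → ∃ _
    from (inj₁ (i , p)) = inj₁ i , p
    from (inj₂ (i , a , p)) = inj₂ (i , a) , p
    to : ∃ _ → _
    to (inj₁ i , p) = inj₁ (i , p)
    to (inj₂ (i , a) , p) = inj₂ (i , a , p)

  open Walks Edge public
  open Distances Edge _≟V_ edge? search public

  lift-walk : ∀ {i j k} → Walk (λ x y → T (adj G x y)) i j k → Walk Edge (inj₁ i) (inj₁ j) k
  lift-walk here = here
  lift-walk (step t walk) = step (base t) (lift-walk walk)

  reachable : Connected G → ∀ {Q} → ∃ Q → ∀ i → ∃[ L ] Reach (inj₁ i) Q L
  reachable conn (inj₁ j , q) i = _ , (inj₁ j , q , lift-walk (proj₂ (conn i j)))
  reachable conn (inj₂ (j , a) , q) i = _ , (_ , q , snoc (lift-walk (proj₂ (conn i j))) toCopy)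

  -- A walk from a copy of K_n to a set avoiding that copy leaves it through
  -- its base vertex i, so i is strictly closer to the set.
  leave-copy : ∀ {Q} i → (∀ a → ¬ Q (inj₂ (i , a))) → ∀ a k → Reach (inj₂ (i , a)) Q k →
               ∃[ j ] (suc j ≤ k × Reach (inj₁ i) Q j)
  leave-copy i miss a zero (_ , q , here) = ⊥-elim (miss a q)
  leave-copy i miss a (suc k) (w , q , step fromCopy rest) = k , ≤-refl , (w , q , rest)
  leave-copy i miss a (suc k) (w , q , step (inCopy {b = b} _) rest) with leave-copy i miss b k (w , q , rest)
  ... | j , j<k , r = j , m≤n⇒m≤1+n j<k , r

  -- Two vertices of the same copy have the same neighbours apart from each other.
  sibling-dominates : ∀ {Q} i a b → (Q (inj₂ (i , a)) → Q (inj₂ (i , b))) →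
                      Dominates (inj₂ (i , a)) (inj₂ (i , b)) Q
  sibling-dominates i a b Qa⇒Qb = neighbourhood-dominates Qa⇒Qb shared
    where
    shared : ∀ {z} → Edge (inj₂ (i , a)) z → z ≡ inj₂ (i , b) ⊎ Edge (inj₂ (i , b)) z
    shared fromCopy = inj₂ fromCopy
    shared (inCopy {b = x} _) with x ≟ b
    ... | yes refl = inj₁ refl
    ... | no x≢b = inj₂ (inCopy (x≢b ∘ sym))

  base-near : ∀ {Q i} → ∃[ a ] Q (inj₂ (i , a)) → ∃[ k ] (k ≤ 1 × Reach (inj₁ i) Q k)
  base-near (a , q) = 1 , ≤-refl , (_ , q , step toCopy here)

  copy-near : ∀ {Q i} b → ∃[ a ] Q (inj₂ (i , a)) → ∃[ k ] (k ≤ 1 × Reach (inj₂ (i , b)) Q k)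
  copy-near b (a , q) with a ≟ b
  ... | yes refl = 0 , z≤n , (_ , q , here)
  ... | no a≢b = 1 , ≤-refl , (_ , q , step (inCopy (a≢b ∘ sym)) here)

module ResolvingCorona {m n : ℕ} (G : SimpleGraph m)
                       (Π : OrderedPartition (CoronaV m (suc n)) (suc (suc n)))
                       (res : Resolving (CoronaAdj G) Π) where

  open Corona {m} {suc n} G

  -- Siblings in a copy are separated only by their classes, so each copy
  -- meets distinct classes.
  copy-classes-injective : ∀ i → Injective _≡_ _≡_ (λ a → cls Π (inj₂ (i , a)))
  copy-classes-injective i {a} {b} same-class
    with unresolved⇒equal {Π = Π} res (λ C → sibling-dominates i a b (trans (sym same-class)) ,
                                     sibling-dominates i b a (trans same-class))
  ... | refl = refl

  copy-covers : ∀ i {c} → (∀ a → ¬ Class Π c (inj₂ (i , a))) → ∀ C → C ≢ c →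
                ∃[ a ] Class Π C (inj₂ (i , a))
  copy-covers i = injection-misses-one _ (copy-classes-injective i)

  module Towards (c : Fin (suc (suc n))) where

    A : Vertex → Set
    A = Class Π c

    A? : ∀ v → Dec (A v)
    A? v = cls Π v ≟ c

    copy-misses : ∀ {i} D → (∀ k → k < 2 + D → ¬ Reach (inj₁ i) A k) → ∀ a → ¬ A (inj₂ (i , a))
    copy-misses D below a q = below 1 (s≤s (s≤s z≤n)) (_ , q , step toCopy here)

    -- If i is at distance 3 + D from A and its neighbour j reaches A in
    -- 2 + D steps, then the vertex of the copy at j lying in the class of i
    -- is at the same distance as i from every class.
    far-vertex-twin : ∀ {i j} D → T (adj G i j) → Reach (inj₁ j) A (2 + D) →
                      (∀ k → k < 3 + D → ¬ Reach (inj₁ i) A k) →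
                      ∃[ b ] Unresolved Π (inj₁ i) (inj₂ (j , b))
    far-vertex-twin {i} {j} D t rj below = b , unresolved
      where
      i-misses : ¬ A (inj₁ i)
      i-misses q = below 0 (s≤s z≤n) (_ , q , here)
      copy-j-misses : ∀ b → ¬ A (inj₂ (j , b))
      copy-j-misses b q = below 2 (s≤s (s≤s (s≤s z≤n))) (_ , q , step (base t) (step toCopy here))
      twin : ∃[ b ] Class Π (cls Π (inj₁ i)) (inj₂ (j , b))
      twin = copy-covers j copy-j-misses (cls Π (inj₁ i)) i-misses
      b : Fin (suc n)
      b = proj₁ twin
      unresolved : Unresolved Π (inj₁ i) (inj₂ (j , b))
      unresolved C with C ≟ c
      -- Towards A: the twin reaches A through j in 3 + D steps, the least
      -- possible for i; and any walk from the twin to A leaves through j.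
      ... | yes refl =
            shortest-dominates (step-reach fromCopy rj) below ,
            λ k ry → let (k' , k'<k , ri) = leave-copy j copy-j-misses b k ry
                     in suc k' , k'<k , step-reach (base t) ri
      -- Towards another class: both copies meet it, so both vertices are
      -- within distance 1 of it, and they share membership in it.
      ... | no C≢c =
            near-dominates (trans (proj₂ twin)) (copy-near b (copy-covers j copy-j-misses C C≢c)) ,
            near-dominates (trans (sym (proj₂ twin))) (base-near (copy-covers i (copy-misses (suc D) below) C C≢c))

    -- No base vertex is at distance 3 or more from A: a shortest walk cannot
    -- start inside the vertex's own copy, and if it starts along an edge of G
    -- the vertex has a twin, contradicting resolvability.
    no-far-base-vertex : ∀ i D → ¬ Shortest (inj₁ i) A (3 + D)
    no-far-base-vertex i D ((w , q , step (base t) rest) , below)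
      with unresolved⇒equal {Π = Π} res (proj₂ (far-vertex-twin D t (w , q , rest) below))
    ... | ()
    no-far-base-vertex i D ((w , q , step toCopy rest) , below) =
      let (k , k<2+D , r) = leave-copy i (copy-misses (suc D) below) _ (2 + D) (w , q , rest)
      in below k (m≤n⇒m≤1+n k<2+D) r

    base-within-two : ∀ i {L} → Reach (inj₁ i) A L → ∃[ k ] (k ≤ 2 × Reach (inj₁ i) A k)
    base-within-two i r with shortest-within A? r
    ... | 0 , (r0 , _) , _ = 0 , z≤n , r0
    ... | 1 , (r1 , _) , _ = 1 , s≤s z≤n , r1
    ... | 2 , (r2 , _) , _ = 2 , ≤-refl , r2
    ... | suc (suc (suc D)) , far , _ = ⊥-elim (no-far-base-vertex i D far)

    within-three : Connected G → ∀ v → ∃[ k ] (k ≤ 3 × Reach v A k)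
    within-three conn (inj₁ i) with base-within-two i (proj₂ (reachable conn (nonempty Π c) i))
    ... | k , k≤2 , r = k , m≤n⇒m≤1+n k≤2 , r
    within-three conn (inj₂ (i , a)) with base-within-two i (proj₂ (reachable conn (nonempty Π c) i))
    ... | k , k≤2 , r = suc k , s≤s k≤2 , step-reach fromCopy r

lemma10 : ∀ {m} (G : SimpleGraph m) → Connected G → (n : ℕ) →
    (Π : OrderedPartition (CoronaV m (suc n)) (suc (suc n))) →
    Resolving (CoronaAdj G) Π →
    ∀ (v : CoronaV m (suc n)) (i : Fin (suc (suc n))) →
    ∃[ k ] (IsSetDist (CoronaAdj G) v (Class Π i) k × k ≤ 3)
lemma10 G conn n Π res v c =
  let (L , L≤3 , r) = within-three conn v
      (k , dist , k≤L) = setDist-within A? r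
  in k , dist , ≤-trans k≤L L≤3
  where
  open Corona {n = suc n} G using (setDist-within)
  open ResolvingCorona G Π res
  open Towards c
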